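{- Let $\mathcal{R}_1,\mathcal{R}_2,\mathcal{S}$ be TRSs and $L$ a set of terms each of which is terminating with respect to $\to_{(\mathcal{R}_1\cup\mathcal{R}_2)/\mathcal{S}}$. Suppose there exist a complexity pair $(\succ,\succsim)$ and a constant $\Delta$ such that $\mathcal{R}_2\subseteq\succ$, $\mathcal{S}\subseteq\succsim$, and for all terms $u,v$, $u\to_{\mathcal{R}_1}v$ implies $\mathrm{dl}(u,\succ)+\Delta\ge\mathrm{dl}(v,\succ)$. Then \[ \mathrm{cp}(n,\to_{(\mathcal{R}_1\cup\mathcal{R}_2)/\mathcal{S}},L)=O\bigl(\mathrm{cp}(n,\to_{\mathcal{R}_1/(\mathcal{R}_2\cup\mathcal{S})},L)+\mathrm{cp}(n,\succ,L)\bigr). \]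
   Context: A TRS is a set of rewrite rules; $\to_{\mathcal{R}}$ is the rewrite relation of $\mathcal{R}$. A rewrite relation is a binary relation on terms closed under contexts and substitutions. A complexity pair $(\succ,\succsim)$ consists of two finitely branching rewrite relations that are compatible: $\succsim\cdot\succ\subseteq\succ$ and $\succ\cdot\succsim\subseteq\succ$. For TRSs $\mathcal{R},\mathcal{S}$: $\to_{\mathcal{R}/\mathcal{S}}=\to_{\mathcal{S}}^*\cdot\to_{\mathcal{R}}\cdot\to_{\mathcal{S}}^*$. $\mathrm{dl}(t,\to)=\sup\{m\mid\exists u,\ t\to^m u\}$; $\mathrm{cp}(n,\to,L)=\sup\{\mathrm{dl}(t,\to)\mid t\in L,|t|\le n\}$ with $|t|$ the size of $t$. $f(n)=O(g(n))$ means $f(n)\le M g(n)$ for all $n\ge N$, for some constants $M,N$. -}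

module Defs where

open import Data.Nat using (ℕ; zero; suc; _+_; _*_; _≤_)
open import Data.Fin using (Fin)
open import Data.Vec using (Vec; []; _∷_; _[_]≔_; lookup)
open import Data.List using (List)
open import Data.List.Membership.Propositional using (_∈_)
open import Data.Product using (Σ; ∃; _×_; _,_)
open import Data.Sum using (_⊎_)
open import Induction.WellFounded using (Acc)
open import Relation.Binary.Construct.Closure.ReflexiveTransitive using (Star)

module TermsOver (F : Set) (ar : F → ℕ) (V : Set) where

  data Term : Set where
    var : V → Term
    fun : (f : F) → Vec Term (ar f) → Term

  Subst : Set
  Subst = V → Term

  mutual
    _·_ : Term → Subst → Term
    var x · σ = σ x
    fun f ts · σ = fun f (ts ·* σ)

    _·*_ : ∀ {n} → Vec Term n → Subst → Vec Term n
    [] ·* σ = []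
    (t ∷ ts) ·* σ = (t · σ) ∷ (ts ·* σ)

  mutual
    size : Term → ℕ
    size (var x) = 1
    size (fun f ts) = suc (sizes ts)

    sizes : ∀ {n} → Vec Term n → ℕ
    sizes [] = 0
    sizes (t ∷ ts) = size t + sizes ts

  Rel : Set₁
  Rel = Term → Term → Set

  TRS : Set₁
  TRS = Term → Term → Set

  _∪_ : TRS → TRS → TRS
  (R ∪ S) l r = R l r ⊎ S l r

  data Step (R : TRS) : Rel where
    root : ∀ {l r} (σ : Subst) → R l r → Step R (l · σ) (r · σ)
    ctx  : ∀ (f : F) (ts : Vec Term (ar f)) (i : Fin (ar f)) {s t} →
           Step R s t → Step R (fun f (ts [ i ]≔ s)) (fun f (ts [ i ]≔ t))

  _⊆ʳ_ : TRS → Rel → Set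
  R ⊆ʳ ≻ = ∀ {l r} → R l r → ≻ l r

  record IsRewriteRelation (≻ : Rel) : Set where
    field
      closed-ctx   : ∀ (f : F) (ts : Vec Term (ar f)) (i : Fin (ar f)) {s t} →
                     ≻ s t → ≻ (fun f (ts [ i ]≔ s)) (fun f (ts [ i ]≔ t))
      closed-subst : ∀ (σ : Subst) {s t} → ≻ s t → ≻ (s · σ) (t · σ)

  FinitelyBranching : Rel → Set
  FinitelyBranching ≻ = ∀ s → Σ (List Term) λ xs → ∀ t → ≻ s t → t ∈ xs

  record IsComplexityPair (≻ ≿ : Rel) : Set where
    field
      ≻-rewrite : IsRewriteRelation ≻
      ≿-rewrite : IsRewriteRelation ≿
      ≻-fb      : FinitelyBranching ≻
      ≿-fb      : FinitelyBranching ≿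
      compat-l  : ∀ {s t u} → ≿ s t → ≻ t u → ≻ s u
      compat-r  : ∀ {s t u} → ≻ s t → ≿ t u → ≻ s u

  _/_ : TRS → TRS → Rel
  (R / S) s t = ∃ λ s' → ∃ λ t' →
    Star (Step S) s s' × Step R s' t' × Star (Step S) t' t

  data Iter (⟶ : Rel) : ℕ → Rel where
    done : ∀ {t} → Iter ⟶ zero t t
    next : ∀ {m s t u} → ⟶ s t → Iter ⟶ m t u → Iter ⟶ (suc m) s u

  SN : Rel → Term → Set
  SN ⟶ = Acc (λ u v → ⟶ v u)

  -- "dl(t, ⟶) ≤ k"  (dl is a sup in ℕ ∪ {∞}; it is ≤ k iff every
  -- derivation from t has length ≤ k)
  dl≤ : Term → Rel → ℕ → Set
  dl≤ t ⟶ k = ∀ m u → Iter ⟶ m t u → m ≤ k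

  cp≤ : ℕ → Rel → (Term → Set) → ℕ → Set
  cp≤ n ⟶ L k = ∀ t → L t → size t ≤ n → dl≤ t ⟶ k

  -- f(n) = O(g(n) + h(n)) for the complexity functions
  -- f = cp(·,A,L), g = cp(·,B,L), h = cp(·,C,L), values in ℕ ∪ {∞}:
  -- ∃ M N. ∀ n ≥ N. f(n) ≤ M * (g(n) + h(n)), where an infinite right side
  -- imposes no constraint, expressed via finite upper bounds.
  cpBigO : Rel → Rel → Rel → (Term → Set) → Set
  cpBigO A B C L = ∃ λ M → ∃ λ N → ∀ n → N ≤ n →
    ∀ a b → cp≤ n B L a → cp≤ n C L b → cp≤ n A L (M * (a + b))

module Submission where

-- Give every term s the potential  c * (1 + Δ) + k,  where
-- c bounds dl(s, →_{R₁/(R₂∪S)}) and k bounds dl(s, ≻).  Each step of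
-- →_{(R₁∪R₂)/S} lowers this potential by at least one:
--   * an R₁-step is a step of →_{R₁/(R₂∪S)}, so c drops by one, while by
--     hypothesis k grows by at most Δ (S-steps never increase dl(·, ≻),
--     because S ⊆ ≿ and ≿ · ≻ ⊆ ≻);
--   * an R₂-step, with its surrounding S-steps, is a single ≻-step, so k
--     drops by one, while c does not grow since the step is an
--     (R₂ ∪ S)-rewrite sequence, invisible to →_{R₁/(R₂∪S)}.
-- Hence dl(t, →_{(R₁∪R₂)/S}) ≤ c (1 + Δ) + k ≤ (1 + Δ)(c + k), which is the
-- claimed bound with constant M = 1 + Δ (from N = 0 on).

open import Defs
open import Data.Nat using (ℕ; zero; suc; _+_; _*_; _≤_; z≤n; s≤s)
open import Data.Nat.Properties
  using (≤-pred; ≤-trans; +-assoc; +-comm; +-suc; +-monoʳ-≤; m≤m*n; *-distribʳ-+; *-comm; module ≤-Reasoning)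
open import Data.Product using (Σ; _×_; _,_)
open import Data.Sum using (_⊎_; inj₁; inj₂)
open import Relation.Binary.Construct.Closure.ReflexiveTransitive using (Star; ε; _◅_; _◅◅_)
open import Relation.Binary.PropositionalEquality using (_≡_; refl; sym; trans; subst)

potential≤ : (Δ c k : ℕ) → c * suc Δ + k ≤ suc Δ * (c + k)
potential≤ Δ c k = begin
    c * suc Δ + k          ≤⟨ +-monoʳ-≤ (c * suc Δ) (m≤m*n k (suc Δ)) ⟩
    c * suc Δ + k * suc Δ  ≡⟨ sym (*-distribʳ-+ (suc Δ) c k) ⟩
    (c + k) * suc Δ        ≡⟨ *-comm (c + k) (suc Δ) ⟩
    suc Δ * (c + k)        ∎
  where open ≤-Reasoning

module _ {F : Set} {ar : F → ℕ} {V : Set} where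
  open TermsOver F ar V

  -- If dl(s, ⟶) ≤ k and s ⟶ s', then k is a successor k' + 1 and
  -- dl(s', ⟶) ≤ k': a derivation from s' extends to one from s.
  dl≤-step : ∀ {⟶ : Rel} {s s' k} → dl≤ s ⟶ k → ⟶ s s' →
             Σ ℕ λ k' → k ≡ suc k' × dl≤ s' ⟶ k'
  dl≤-step {k = zero}   bound s⟶s' with bound 1 _ (next s⟶s' done)
  ... | ()
  dl≤-step {k = suc k'} bound s⟶s' =
    k' , refl , λ m u s'⟶ᵐu → ≤-pred (bound (suc m) u (next s⟶s' s'⟶ᵐu))

  dl≤-transfer : ∀ {⟶ : Rel} {s s' k} → (∀ {t} → ⟶ s' t → ⟶ s t) →
                 dl≤ s ⟶ k → dl≤ s' ⟶ k
  dl≤-transfer first bound zero    u done             = z≤n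
  dl≤-transfer first bound (suc m) u (next step rest) = bound (suc m) u (next (first step) rest)

  step-mono : ∀ {R R' : TRS} → (∀ {l r} → R l r → R' l r) →
              ∀ {s t} → Step R s t → Step R' s t
  step-mono sub (root σ rule)      = root σ (sub rule)
  step-mono sub (ctx f ts i inner) = ctx f ts i (step-mono sub inner)

  star-mono : ∀ {A B : Rel} → (∀ {s t} → A s t → B s t) →
              ∀ {s t} → Star A s t → Star B s t
  star-mono sub ε            = ε
  star-mono sub (step ◅ rest) = sub step ◅ star-mono sub rest

  step-split : ∀ {R₁ R₂ : TRS} {s t} → Step (R₁ ∪ R₂) s t → Step R₁ s t ⊎ Step R₂ s t
  step-split (root σ (inj₁ rule)) = inj₁ (root σ rule)
  step-split (root σ (inj₂ rule)) = inj₂ (root σ rule)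
  step-split (ctx f ts i inner) with step-split inner
  ... | inj₁ step = inj₁ (ctx f ts i step)
  ... | inj₂ step = inj₂ (ctx f ts i step)

  step⊆ : ∀ {R : TRS} {≻ : Rel} → IsRewriteRelation ≻ → R ⊆ʳ ≻ →
          ∀ {s t} → Step R s t → ≻ s t
  step⊆ rr sub (root σ rule)      = IsRewriteRelation.closed-subst rr σ (sub rule)
  step⊆ rr sub (ctx f ts i inner) = IsRewriteRelation.closed-ctx rr f ts i (step⊆ rr sub inner)

  module Absorb {≻ ≿ : Rel} (pair : IsComplexityPair ≻ ≿) {S : TRS} (S⊆≿ : S ⊆ʳ ≿) where
    open IsComplexityPair pair

    absorbˡ : ∀ {s s' t} → Star (Step S) s s' → ≻ s' t → ≻ s t
    absorbˡ ε            s'≻t = s'≻t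
    absorbˡ (step ◅ rest) s'≻t = compat-l (step⊆ ≿-rewrite S⊆≿ step) (absorbˡ rest s'≻t)

    absorbʳ : ∀ {s t t'} → ≻ s t → Star (Step S) t t' → ≻ s t'
    absorbʳ s≻t ε             = s≻t
    absorbʳ s≻t (step ◅ rest) = absorbʳ (compat-r s≻t (step⊆ ≿-rewrite S⊆≿ step)) rest

    dl≤-S* : ∀ {s s' k} → Star (Step S) s s' → dl≤ s ≻ k → dl≤ s' ≻ k
    dl≤-S* steps = dl≤-transfer (absorbˡ steps)

  data Classified (R₁ R₂ S : TRS) (s t : Term) : Set where
    viaR₁ : ∀ {s' t'} → Star (Step S) s s' → Step R₁ s' t' → Star (Step S) t' t →
            Classified R₁ R₂ S s t
    viaR₂ : ∀ {s' t'} → Star (Step S) s s' → Step R₂ s' t' → Star (Step S) t' t →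
            Classified R₁ R₂ S s t

  classify : ∀ {R₁ R₂ S : TRS} {s t} → ((R₁ ∪ R₂) / S) s t → Classified R₁ R₂ S s t
  classify (_ , _ , pre , step , post) with step-split step
  ... | inj₁ step₁ = viaR₁ pre step₁ post
  ... | inj₂ step₂ = viaR₂ pre step₂ post

  dl≤-relative* : ∀ {R₁ Q : TRS} {s s' c} → Star (Step Q) s s' →
                  dl≤ s (R₁ / Q) c → dl≤ s' (R₁ / Q) c
  dl≤-relative* steps = dl≤-transfer λ { (a , b , pre , step , post) → (a , b , steps ◅◅ pre , step , post) }

  module Potential (R₁ R₂ S : TRS) {≻ ≿ : Rel} (Δ : ℕ) (pair : IsComplexityPair ≻ ≿)
                   (R₂⊆≻ : R₂ ⊆ʳ ≻) (S⊆≿ : S ⊆ʳ ≿)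
                   (R₁-Δ : ∀ u v → Step R₁ u v → ∀ k → dl≤ u ≻ k → dl≤ v ≻ (k + Δ)) where
    open IsComplexityPair pair using (≻-rewrite)
    open Absorb pair S⊆≿

    inj-S : ∀ {s t} → Star (Step S) s t → Star (Step (R₂ ∪ S)) s t
    inj-S = star-mono (step-mono inj₂)

    -- Any derivation of length m from s is bounded by the potential of s.
    -- R₁-case: c = c' + 1 and the ≻-budget becomes k + Δ;
    -- R₂-case: k = k' + 1 and the relative budget c is kept.
    potential-bound : ∀ {m s u} → Iter ((R₁ ∪ R₂) / S) m s u →
                      ∀ c k → dl≤ s (R₁ / (R₂ ∪ S)) c → dl≤ s ≻ k → m ≤ c * suc Δ + k
    potential-bound done c k _ _ = z≤n
    potential-bound {suc m} (next step rest) c k dlB dl≻ with classify step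
    ... | viaR₁ pre step₁ post
          with dl≤-step dlB (_ , _ , inj-S pre , step₁ , inj-S post)
    ...   | c' , refl , dlB' = s≤s (subst (m ≤_) regroup ih)
      where
      ih : m ≤ c' * suc Δ + (k + Δ)
      ih = potential-bound rest c' (k + Δ) dlB'
             (dl≤-S* post (R₁-Δ _ _ step₁ k (dl≤-S* pre dl≻)))
      regroup : c' * suc Δ + (k + Δ) ≡ Δ + c' * suc Δ + k
      regroup = trans (sym (+-assoc (c' * suc Δ) k Δ))
                  (trans (+-comm (c' * suc Δ + k) Δ) (sym (+-assoc Δ (c' * suc Δ) k)))
    potential-bound {suc m} (next step rest) c k dlB dl≻ | viaR₂ pre step₂ post
          with dl≤-step dl≻ (absorbʳ (absorbˡ pre (step⊆ ≻-rewrite R₂⊆≻ step₂)) post)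
    ...   | k' , refl , dl≻' = subst (suc m ≤_) (sym (+-suc (c * suc Δ) k')) (s≤s ih)
      where
      ih : m ≤ c * suc Δ + k'
      ih = potential-bound rest c k'
             (dl≤-relative* (inj-S pre ◅◅ step-mono inj₁ step₂ ◅ inj-S post) dlB) dl≻'

theorem4p6 : (F : Set) (ar : F → ℕ) (V : Set) →
    let open TermsOver F ar V in
    (R₁ R₂ S : TRS) (L : Term → Set) →
    (∀ t → L t → SN ((R₁ ∪ R₂) / S) t) →
    (≻ ≿ : Rel) (Δ : ℕ) →
    IsComplexityPair ≻ ≿ →
    R₂ ⊆ʳ ≻ →
    S ⊆ʳ ≿ →
    (∀ u v → Step R₁ u v → ∀ k → dl≤ u ≻ k → dl≤ v ≻ (k + Δ)) →
    cpBigO ((R₁ ∪ R₂) / S) (R₁ / (R₂ ∪ S)) ≻ L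
theorem4p6 F ar V R₁ R₂ S L _ ≻ ≿ Δ pair R₂⊆≻ S⊆≿ R₁-Δ =
  suc Δ , 0 , λ n _ c k cpB cp≻ t t∈L |t|≤n m u derivation →
    ≤-trans (potential-bound derivation c k (cpB t t∈L |t|≤n) (cp≻ t t∈L |t|≤n))
            (potential≤ Δ c k)
  where open Potential R₁ R₂ S Δ pair R₂⊆≻ S⊆≿ R₁-Δ
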